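{- Let $G$ be a graph and let $\ell$ be a $2$-intersecting supermodular weakly subadditive integer-valued function on subsets of $V(G)$. Let $F$ be a spanning $\ell$-sparse subgraph of $G$, let $xy\in E(G)\setminus E(F)$, and let $Q$ be an $\ell$-rigid subgraph of $F$ containing $x$ and $y$ with the minimum number of vertices. Then for every $e\in E(Q)$, the graph $F-e+xy$ is $\ell$-sparse.
   Context: Graphs are finite, loopless, multiple edges allowed. $e_H(X)$ denotes the number of edges of $H$ with both ends in $X$. Set functions are zero on $\emptyset$, $\ell(v)=\ell(\{v\})$. $\ell$ is $2$-intersecting supermodular if $\ell(A\cap B)+\ell(A\cup B)\ge\ell(A)+\ell(B)$ whenever $|A\cap B|\ge 2$; weakly subadditive if $\sum_{v\in A}\ell(v)\ge\ell(A)$ for all $A$. A spanning subgraph $F$ is $\ell$-sparse if $e_F(X)\le\sum_{v\in X}\ell(v)-\ell(X)$ for all vertex sets $X$. A graph $H$ is $\ell$-rigid if it has a spanning $\ell$-sparse subgraph $F'$ with $|E(F')|=\sum_{v\in V(H)}\ell(v)-\ell(V(H))$. -}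

module Defs where

open import Data.Nat using (ℕ; zero; suc)
open import Data.Bool using (Bool; true; false; _∧_; if_then_else_)
open import Data.Fin using (Fin)
import Data.Fin as F
open import Data.Fin.Subset using (Subset; ⁅_⁆; _∈_; _∉_; _⊆_; _∩_; _∪_; ∣_∣)
open import Data.Vec using (lookup; tabulate)
open import Data.Integer using (ℤ; +_; _+_; _-_; _≤_; 0ℤ)
open import Data.Product using (Σ; _×_; _,_; proj₁; proj₂)
open import Relation.Binary.PropositionalEquality using (_≡_; _≢_)

-- A (loopless multi)graph on vertex set Fin n with m edges indexed by Fin m;
-- each edge has two distinct endpoints. Parallel edges are allowed.
record Graph (n m : ℕ) : Set where
  field
    ends     : Fin m → Fin n × Fin n
    loopless : (i : Fin m) → proj₁ (ends i) ≢ proj₂ (ends i)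
open Graph public

sumFin : {n : ℕ} → (Fin n → ℤ) → ℤ
sumFin {zero}  f = 0ℤ
sumFin {suc n} f = f F.zero + sumFin (λ i → f (F.suc i))

SetFun : ℕ → Set
SetFun n = Subset n → ℤ

Σℓ : {n : ℕ} → SetFun n → Subset n → ℤ
Σℓ ℓ X = sumFin (λ v → if lookup X v then ℓ ⁅ v ⁆ else 0ℤ)

inside : {n m : ℕ} → Graph n m → Subset n → Subset m
inside G X = tabulate (λ i → lookup X (proj₁ (ends G i)) ∧ lookup X (proj₂ (ends G i)))

eIn : {n m : ℕ} → Graph n m → Subset m → Subset n → ℕ
eIn G S X = ∣ S ∩ inside G X ∣

TwoIntersectingSupermodular : {n : ℕ} → SetFun n → Set
TwoIntersectingSupermodular ℓ =
  ∀ A B → 2 Data.Nat.≤ ∣ A ∩ B ∣ → ℓ A + ℓ B ≤ ℓ (A ∩ B) + ℓ (A ∪ B)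

WeaklySubadditive : {n : ℕ} → SetFun n → Set
WeaklySubadditive ℓ = ∀ A → ℓ A ≤ Σℓ ℓ A

-- ℓ-sparsity of a spanning subgraph with edge set S of G, tested on all vertex sets X ⊆ W
-- (W = V(G) for spanning subgraphs of G; W = V(H) for spanning subgraphs of a subgraph H).
SparseOn : {n m : ℕ} → Graph n m → SetFun n → Subset n → Subset m → Set
SparseOn G ℓ W S = ∀ X → X ⊆ W → + eIn G S X ≤ Σℓ ℓ X - ℓ X

Sparse : {n m : ℕ} → Graph n m → SetFun n → Subset m → Set
Sparse G ℓ S = ∀ X → + eIn G S X ≤ Σℓ ℓ X - ℓ X

IsSubgraphOf : {n m : ℕ} → Graph n m → Subset n → Subset m → Subset m → Set
IsSubgraphOf G W T S = T ⊆ S × (∀ i → i ∈ T → proj₁ (ends G i) ∈ W × proj₂ (ends G i) ∈ W)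

Rigid : {n m : ℕ} → Graph n m → SetFun n → Subset n → Subset m → Set
Rigid G ℓ W T = Σ (Subset _) λ T' → T' ⊆ T × SparseOn G ℓ W T' × (+ ∣ T' ∣ ≡ Σℓ ℓ W - ℓ W)

-- Only a set X containing x and y but not both ends of e
-- can gain an edge, so a violation at X forces X to be tight in F, i.e.
-- e_F(X) = Σ_{v∈X} ℓ(v) − ℓ(X). The vertex set of Q is tight as well, because
-- Q is rigid. Since x, y ∈ X ∩ V(Q), the intersection has two vertices, and
-- 2-intersecting supermodularity of ℓ together with supermodularity of e_F makes
-- X ∩ V(Q) tight; it therefore spans an ℓ-rigid subgraph of F containing x and y.
-- Minimality of Q gives V(Q) ⊆ X, so both ends of e lie in X: a contradiction.
module Submission where

open import Defs
open import Data.Nat using (ℕ; _≤_)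
open import Data.Bool using (false)
open import Data.Fin using (Fin)
open import Data.Fin.Subset using (Subset; ⊥; ⁅_⁆; _∈_; _∉_; _∪_; _─_; ∣_∣)
open import Data.Vec using (lookup)
open import Data.Integer using (0ℤ)
open import Data.Product using (_×_; _,_)
open import Relation.Binary.PropositionalEquality using (_≡_)

import Data.Nat as ℕ
import Data.Fin as Fin
import Data.Nat.Properties as ℕP
open import Data.Integer as ℤ using (ℤ; +_; +≤+)
import Data.Integer.Properties as ℤP
open import Data.Integer.Tactic.RingSolver using (solve-∀)
open import Data.Bool using (Bool; true; _∧_; _∨_; if_then_else_)
open import Data.Vec using ([]; _∷_; here; there)
open import Data.Vec.Properties using (lookup∘tabulate; []=⇒lookup; lookup⇒[]=)
open import Data.Fin.Subset using (_∩_; _⊆_; _-_)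
open import Data.Fin.Subset.Properties
open import Data.Product using (proj₁; proj₂)
open import Data.Sum using (_⊎_; inj₁; inj₂)
open import Relation.Nullary using (yes; no; contradiction)
open import Relation.Binary.PropositionalEquality using (_≢_; refl; sym; trans; cong; cong₂; subst; module ≡-Reasoning)

private
  variable
    n m : ℕ

∣p∩q∣+∣p∪q∣≡∣p∣+∣q∣ : (p q : Subset n) → ∣ p ∩ q ∣ ℕ.+ ∣ p ∪ q ∣ ≡ ∣ p ∣ ℕ.+ ∣ q ∣
∣p∩q∣+∣p∪q∣≡∣p∣+∣q∣ [] [] = refl
∣p∩q∣+∣p∪q∣≡∣p∣+∣q∣ (true ∷ p) (true ∷ q) =
  cong ℕ.suc (trans (ℕP.+-suc _ _) (trans (cong ℕ.suc (∣p∩q∣+∣p∪q∣≡∣p∣+∣q∣ p q)) (sym (ℕP.+-suc _ _))))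
∣p∩q∣+∣p∪q∣≡∣p∣+∣q∣ (true ∷ p) (false ∷ q) =
  trans (ℕP.+-suc _ _) (cong ℕ.suc (∣p∩q∣+∣p∪q∣≡∣p∣+∣q∣ p q))
∣p∩q∣+∣p∪q∣≡∣p∣+∣q∣ (false ∷ p) (true ∷ q) =
  trans (ℕP.+-suc _ _) (trans (cong ℕ.suc (∣p∩q∣+∣p∪q∣≡∣p∣+∣q∣ p q)) (sym (ℕP.+-suc _ _)))
∣p∩q∣+∣p∪q∣≡∣p∣+∣q∣ (false ∷ p) (false ∷ q) = ∣p∩q∣+∣p∪q∣≡∣p∣+∣q∣ p q

∣p∪⁅x⁆∣≤1+∣p∣ : (p : Subset n) (x : Fin n) → ∣ p ∪ ⁅ x ⁆ ∣ ≤ ℕ.suc ∣ p ∣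
∣p∪⁅x⁆∣≤1+∣p∣ p x = ℕP.≤-trans (ℕP.m≤n+m _ _) (ℕP.≤-reflexive (begin
  ∣ p ∩ ⁅ x ⁆ ∣ ℕ.+ ∣ p ∪ ⁅ x ⁆ ∣ ≡⟨ ∣p∩q∣+∣p∪q∣≡∣p∣+∣q∣ p ⁅ x ⁆ ⟩
  ∣ p ∣ ℕ.+ ∣ ⁅ x ⁆ ∣             ≡⟨ cong (∣ p ∣ ℕ.+_) (∣⁅x⁆∣≡1 x) ⟩
  ∣ p ∣ ℕ.+ 1                     ≡⟨ ℕP.+-comm ∣ p ∣ 1 ⟩
  ℕ.suc ∣ p ∣                     ∎))
  where open ≡-Reasoning

x∈p∧y∈p∧x≢y⇒2≤∣p∣ : {x y : Fin n} (p : Subset n) → x ∈ p → y ∈ p → x ≢ y → 2 ≤ ∣ p ∣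
x∈p∧y∈p∧x≢y⇒2≤∣p∣ {x = x} {y} p x∈p y∈p x≢y =
  ℕP.≤-trans (ℕ.s≤s (ℕP.≤-trans (ℕP.≤-reflexive (sym (∣⁅x⁆∣≡1 y))) (p⊆q⇒∣p∣≤∣q∣ ⁅y⁆⊆p-x)))
             (x∈p⇒∣p-x∣<∣p∣ x∈p)
  where
  ⁅y⁆⊆p-x : ⁅ y ⁆ ⊆ p - x
  ⁅y⁆⊆p-x z∈⁅y⁆ with x∈⁅y⁆⇒x≡y y z∈⁅y⁆
  ... | refl = x∈p∧x≢y⇒x∈p-y y∈p (λ y≡x → x≢y (sym y≡x))

∣q∣≤∣p∩q∣⇒q⊆p : (p q : Subset n) → ∣ q ∣ ≤ ∣ p ∩ q ∣ → q ⊆ p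
∣q∣≤∣p∩q∣⇒q⊆p p q ∣q∣≤∣p∩q∣ {z} z∈q with z ∈? p
... | yes z∈p = z∈p
... | no z∉p = contradiction ∣q∣≤∣p∩q∣
  (ℕP.<⇒≱ (p⊂q⇒∣p∣<∣q∣ (p∩q⊆q p q , z , z∈q , λ z∈p∩q → z∉p (p∩q⊆p p q z∈p∩q))))

x∈p─q⇒x∉q : {x : Fin n} (p q : Subset n) → x ∈ p ─ q → x ∉ q
x∈p─q⇒x∉q (_ ∷ p) (true ∷ q) () here
x∈p─q⇒x∉q (_ ∷ p) (_ ∷ q) (there x∈p─q) (there x∈q) = x∈p─q⇒x∉q p q x∈p─q x∈q

x∈p-y⇒x≢y : {x y : Fin n} (p : Subset n) → x ∈ p - y → x ≢ y
x∈p-y⇒x≢y {y = y} p x∈p-y refl = x∈p─q⇒x∉q p ⁅ y ⁆ x∈p-y (x∈⁅x⁆ y)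

∈-exchange⁻ : {i x y : Fin n} (p : Subset n) → i ∈ (p - x) ∪ ⁅ y ⁆ → (i ∈ p × i ≢ x) ⊎ i ≡ y
∈-exchange⁻ {x = x} {y} p i∈ with x∈p∪q⁻ (p - x) ⁅ y ⁆ i∈
... | inj₁ i∈p-x = inj₁ (p─q⊆p p ⁅ x ⁆ i∈p-x , x∈p-y⇒x≢y p i∈p-x)
... | inj₂ i∈⁅y⁆ = inj₂ (x∈⁅y⁆⇒x≡y y i∈⁅y⁆)

module _ {x y : Fin n} (p q : Subset n) where

  y∉q⇒∣[p-x]∪⁅y⁆∩q∣≤∣p∩q∣ : y ∉ q → ∣ ((p - x) ∪ ⁅ y ⁆) ∩ q ∣ ≤ ∣ p ∩ q ∣
  y∉q⇒∣[p-x]∪⁅y⁆∩q∣≤∣p∩q∣ y∉q = p⊆q⇒∣p∣≤∣q∣ sub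
    where
    sub : ((p - x) ∪ ⁅ y ⁆) ∩ q ⊆ p ∩ q
    sub i∈ with x∈p∩q⁻ _ q i∈
    ... | i∈p' , i∈q with ∈-exchange⁻ p i∈p'
    ... | inj₁ (i∈p , _) = x∈p∩q⁺ (i∈p , i∈q)
    ... | inj₂ refl = contradiction i∈q y∉q

  x∈p∩q⇒∣[p-x]∪⁅y⁆∩q∣≤∣p∩q∣ : x ∈ p ∩ q → ∣ ((p - x) ∪ ⁅ y ⁆) ∩ q ∣ ≤ ∣ p ∩ q ∣
  x∈p∩q⇒∣[p-x]∪⁅y⁆∩q∣≤∣p∩q∣ x∈p∩q =
    ℕP.≤-trans (p⊆q⇒∣p∣≤∣q∣ sub) (ℕP.≤-trans (∣p∪⁅x⁆∣≤1+∣p∣ ((p ∩ q) - x) y) (x∈p⇒∣p-x∣<∣p∣ x∈p∩q))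
    where
    sub : ((p - x) ∪ ⁅ y ⁆) ∩ q ⊆ ((p ∩ q) - x) ∪ ⁅ y ⁆
    sub i∈ with x∈p∩q⁻ _ q i∈
    ... | i∈p' , i∈q with ∈-exchange⁻ p i∈p'
    ... | inj₁ (i∈p , i≢x) = x∈p∪q⁺ (inj₁ (x∈p∧x≢y⇒x∈p-y (x∈p∩q⁺ (i∈p , i∈q)) i≢x))
    ... | inj₂ refl = x∈p∪q⁺ (inj₂ (x∈⁅x⁆ y))

  ∣[p-x]∪⁅y⁆∩q∣≤1+∣p∩q∣ : ∣ ((p - x) ∪ ⁅ y ⁆) ∩ q ∣ ≤ ℕ.suc ∣ p ∩ q ∣
  ∣[p-x]∪⁅y⁆∩q∣≤1+∣p∩q∣ = ℕP.≤-trans (p⊆q⇒∣p∣≤∣q∣ sub) (∣p∪⁅x⁆∣≤1+∣p∣ (p ∩ q) y)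
    where
    sub : ((p - x) ∪ ⁅ y ⁆) ∩ q ⊆ (p ∩ q) ∪ ⁅ y ⁆
    sub i∈ with x∈p∩q⁻ _ q i∈
    ... | i∈p' , i∈q with ∈-exchange⁻ p i∈p'
    ... | inj₁ (i∈p , _) = x∈p∪q⁺ (inj₁ (x∈p∩q⁺ (i∈p , i∈q)))
    ... | inj₂ refl = x∈p∪q⁺ (inj₂ (x∈⁅x⁆ y))

module _ (G : Graph n m) where

  i∈inside⁻ : ∀ X {i} → i ∈ inside G X → proj₁ (ends G i) ∈ X × proj₂ (ends G i) ∈ X
  i∈inside⁻ X {i} i∈ = ends∈ (lookup X (proj₁ (ends G i))) (lookup X (proj₂ (ends G i))) refl refl
    (trans (sym (lookup∘tabulate _ i)) ([]=⇒lookup i∈))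
    where
    ends∈ : (a b : Bool) → lookup X (proj₁ (ends G i)) ≡ a → lookup X (proj₂ (ends G i)) ≡ b →
            a ∧ b ≡ true → proj₁ (ends G i) ∈ X × proj₂ (ends G i) ∈ X
    ends∈ true true u∈X v∈X refl = lookup⇒[]= _ X u∈X , lookup⇒[]= _ X v∈X

  i∈inside⁺ : ∀ X {i} → proj₁ (ends G i) ∈ X → proj₂ (ends G i) ∈ X → i ∈ inside G X
  i∈inside⁺ X {i} u∈X v∈X =
    lookup⇒[]= i _ (trans (lookup∘tabulate _ i) (cong₂ _∧_ ([]=⇒lookup u∈X) ([]=⇒lookup v∈X)))

  inside-mono : ∀ {X Y} → X ⊆ Y → inside G X ⊆ inside G Y
  inside-mono {X} {Y} X⊆Y i∈ with i∈inside⁻ X i∈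
  ... | u∈X , v∈X = i∈inside⁺ Y (X⊆Y u∈X) (X⊆Y v∈X)

  inside-∩ : ∀ X Y {i} → i ∈ inside G X → i ∈ inside G Y → i ∈ inside G (X ∩ Y)
  inside-∩ X Y i∈X i∈Y with i∈inside⁻ X i∈X | i∈inside⁻ Y i∈Y
  ... | u∈X , v∈X | u∈Y , v∈Y = i∈inside⁺ (X ∩ Y) (x∈p∩q⁺ (u∈X , u∈Y)) (x∈p∩q⁺ (v∈X , v∈Y))

  eIn-mono : ∀ {S T} X → S ⊆ T → eIn G S X ≤ eIn G T X
  eIn-mono {S} X S⊆T = p⊆q⇒∣p∣≤∣q∣ λ i∈ →
    let i∈S , i∈I = x∈p∩q⁻ S _ i∈ in x∈p∩q⁺ (S⊆T i∈S , i∈I)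

  induced-isSubgraphOf : ∀ S W → IsSubgraphOf G W (S ∩ inside G W) S
  induced-isSubgraphOf S W = p∩q⊆p S _ , λ i i∈ → i∈inside⁻ W (p∩q⊆q S _ i∈)

  eIn-supermodular : ∀ S X Y → eIn G S X ℕ.+ eIn G S Y ≤ eIn G S (X ∩ Y) ℕ.+ eIn G S (X ∪ Y)
  eIn-supermodular S X Y = ℕP.≤-trans (ℕP.≤-reflexive (sym (∣p∩q∣+∣p∪q∣≡∣p∣+∣q∣ A B)))
    (ℕP.+-mono-≤ (p⊆q⇒∣p∣≤∣q∣ A∩B⊆) (p⊆q⇒∣p∣≤∣q∣ A∪B⊆))
    where
    A = S ∩ inside G X
    B = S ∩ inside G Y
    A∩B⊆ : A ∩ B ⊆ S ∩ inside G (X ∩ Y)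
    A∩B⊆ i∈ with x∈p∩q⁻ A B i∈
    ... | i∈A , i∈B with x∈p∩q⁻ S _ i∈A | x∈p∩q⁻ S _ i∈B
    ... | i∈S , i∈X | _ , i∈Y = x∈p∩q⁺ (i∈S , inside-∩ X Y i∈X i∈Y)
    A∪B⊆ : A ∪ B ⊆ S ∩ inside G (X ∪ Y)
    A∪B⊆ i∈ with x∈p∪q⁻ A B i∈
    ... | inj₁ i∈A = let i∈S , i∈X = x∈p∩q⁻ S _ i∈A in
                     x∈p∩q⁺ (i∈S , inside-mono {X} (p⊆p∪q Y) i∈X)
    ... | inj₂ i∈B = let i∈S , i∈Y = x∈p∩q⁻ S _ i∈B in
                     x∈p∩q⁺ (i∈S , inside-mono {Y} (q⊆p∪q X Y) i∈Y)

sumOver : (Fin n → ℤ) → Subset n → ℤ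
sumOver g X = sumFin (λ v → if lookup X v then g v else 0ℤ)

sumOver-modular : (g : Fin n → ℤ) (X Y : Subset n) →
                  sumOver g (X ∩ Y) ℤ.+ sumOver g (X ∪ Y) ≡ sumOver g X ℤ.+ sumOver g Y
sumOver-modular g [] [] = refl
sumOver-modular g (a ∷ X) (b ∷ Y) = begin
  (g? (a ∧ b) ℤ.+ Σ' (X ∩ Y)) ℤ.+ (g? (a ∨ b) ℤ.+ Σ' (X ∪ Y))
    ≡⟨ +-interchange (g? (a ∧ b)) _ (g? (a ∨ b)) _ ⟩
  (g? (a ∧ b) ℤ.+ g? (a ∨ b)) ℤ.+ (Σ' (X ∩ Y) ℤ.+ Σ' (X ∪ Y))
    ≡⟨ cong₂ ℤ._+_ (g?-modular a b) (sumOver-modular (λ i → g (Fin.suc i)) X Y) ⟩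
  (g? a ℤ.+ g? b) ℤ.+ (Σ' X ℤ.+ Σ' Y)
    ≡⟨ +-interchange (g? a) (g? b) _ _ ⟩
  (g? a ℤ.+ Σ' X) ℤ.+ (g? b ℤ.+ Σ' Y) ∎
  where
  open ≡-Reasoning
  g? : Bool → ℤ
  g? c = if c then g Fin.zero else 0ℤ
  Σ' : Subset _ → ℤ
  Σ' = sumOver (λ i → g (Fin.suc i))
  +-interchange : ∀ p q r s → (p ℤ.+ q) ℤ.+ (r ℤ.+ s) ≡ (p ℤ.+ r) ℤ.+ (q ℤ.+ s)
  +-interchange = solve-∀
  g?-modular : ∀ a b → g? (a ∧ b) ℤ.+ g? (a ∨ b) ≡ g? a ℤ.+ g? b
  g?-modular true  true  = refl
  g?-modular true  false = ℤP.+-comm 0ℤ (g Fin.zero)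
  g?-modular false true  = refl
  g?-modular false false = refl

+-cancelʳ-≤ : ∀ c {a b} → a ℤ.+ c ℤ.≤ b ℤ.+ c → a ℤ.≤ b
+-cancelʳ-≤ c {a} {b} a+c≤b+c = begin
  a             ≡⟨ [x+y]-y≡x a c ⟨
  a ℤ.+ c ℤ.- c ≤⟨ ℤP.+-monoˡ-≤ (ℤ.- c) a+c≤b+c ⟩
  b ℤ.+ c ℤ.- c ≡⟨ [x+y]-y≡x b c ⟩
  b             ∎
  where
  open ℤP.≤-Reasoning
  [x+y]-y≡x : ∀ x y → x ℤ.+ y ℤ.- y ≡ x
  [x+y]-y≡x = solve-∀

bound : SetFun n → Subset n → ℤ
bound ℓ X = Σℓ ℓ X ℤ.- ℓ X

bound-submodular : (ℓ : SetFun n) → TwoIntersectingSupermodular ℓ → ∀ X Y → 2 ≤ ∣ X ∩ Y ∣ →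
                   bound ℓ (X ∩ Y) ℤ.+ bound ℓ (X ∪ Y) ℤ.≤ bound ℓ X ℤ.+ bound ℓ Y
bound-submodular ℓ sup X Y 2≤∣X∩Y∣ = begin
  (Σℓ ℓ (X ∩ Y) ℤ.- ℓ (X ∩ Y)) ℤ.+ (Σℓ ℓ (X ∪ Y) ℤ.- ℓ (X ∪ Y))
    ≡⟨ -‿+-interchange (Σℓ ℓ (X ∩ Y)) _ (ℓ (X ∩ Y)) _ ⟩
  (Σℓ ℓ (X ∩ Y) ℤ.+ Σℓ ℓ (X ∪ Y)) ℤ.- (ℓ (X ∩ Y) ℤ.+ ℓ (X ∪ Y))
    ≡⟨ cong (ℤ._- (ℓ (X ∩ Y) ℤ.+ ℓ (X ∪ Y))) (sumOver-modular (λ v → ℓ ⁅ v ⁆) X Y) ⟩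
  (Σℓ ℓ X ℤ.+ Σℓ ℓ Y) ℤ.- (ℓ (X ∩ Y) ℤ.+ ℓ (X ∪ Y))
    ≤⟨ ℤP.+-monoʳ-≤ (Σℓ ℓ X ℤ.+ Σℓ ℓ Y) (ℤP.neg-mono-≤ (sup X Y 2≤∣X∩Y∣)) ⟩
  (Σℓ ℓ X ℤ.+ Σℓ ℓ Y) ℤ.- (ℓ X ℤ.+ ℓ Y)
    ≡⟨ -‿+-interchange (Σℓ ℓ X) _ (ℓ X) _ ⟨
  (Σℓ ℓ X ℤ.- ℓ X) ℤ.+ (Σℓ ℓ Y ℤ.- ℓ Y) ∎
  where
  open ℤP.≤-Reasoning
  -‿+-interchange : ∀ a b c d → (a ℤ.- c) ℤ.+ (b ℤ.- d) ≡ (a ℤ.+ b) ℤ.- (c ℤ.+ d)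
  -‿+-interchange = solve-∀

Tight : Graph n m → SetFun n → Subset m → Subset n → Set
Tight G ℓ S X = bound ℓ X ℤ.≤ + eIn G S X

module _ (G : Graph n m) (ℓ : SetFun n) (S : Subset m) (S-sparse : Sparse G ℓ S) where

  tight-∩ : TwoIntersectingSupermodular ℓ → ∀ {X Y} → 2 ≤ ∣ X ∩ Y ∣ →
            Tight G ℓ S X → Tight G ℓ S Y → Tight G ℓ S (X ∩ Y)
  tight-∩ sup {X} {Y} 2≤∣X∩Y∣ X-tight Y-tight = +-cancelʳ-≤ (bound ℓ (X ∪ Y)) (begin
    bound ℓ (X ∩ Y) ℤ.+ bound ℓ (X ∪ Y)   ≤⟨ bound-submodular ℓ sup X Y 2≤∣X∩Y∣ ⟩
    bound ℓ X ℤ.+ bound ℓ Y               ≤⟨ ℤP.+-mono-≤ X-tight Y-tight ⟩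
    + eIn G S X ℤ.+ + eIn G S Y           ≤⟨ +≤+ (eIn-supermodular G S X Y) ⟩
    + eIn G S (X ∩ Y) ℤ.+ + eIn G S (X ∪ Y) ≤⟨ ℤP.+-monoʳ-≤ (+ eIn G S (X ∩ Y)) (S-sparse (X ∪ Y)) ⟩
    + eIn G S (X ∩ Y) ℤ.+ bound ℓ (X ∪ Y) ∎)
    where open ℤP.≤-Reasoning

  tight⇒induced-rigid : ∀ {W} → Tight G ℓ S W → Rigid G ℓ W (S ∩ inside G W)
  tight⇒induced-rigid {W} W-tight =
    S ∩ inside G W , ⊆-refl ,
    (λ Y _ → ℤP.≤-trans (+≤+ (eIn-mono G Y (p∩q⊆p S (inside G W)))) (S-sparse Y)) ,
    ℤP.≤-antisym (S-sparse W) W-tight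

rigid⇒tight : (G : Graph n m) (ℓ : SetFun n) {S : Subset m} {W : Subset n} {T : Subset m} →
              IsSubgraphOf G W T S → Rigid G ℓ W T → Tight G ℓ S W
rigid⇒tight G ℓ {S} {W} (T⊆S , T-ends) (T' , T'⊆T , _ , ∣T'∣≡bound) =
  ℤP.≤-trans (ℤP.≤-reflexive (sym ∣T'∣≡bound)) (+≤+ (p⊆q⇒∣p∣≤∣q∣ T'⊆S∩inside))
  where
  T'⊆S∩inside : T' ⊆ S ∩ inside G W
  T'⊆S∩inside i∈T' = let i∈T = T'⊆T i∈T' ; u∈W , v∈W = T-ends _ i∈T in
    x∈p∩q⁺ (T⊆S i∈T , i∈inside⁺ G W u∈W v∈W)

minimal-rigid⊆tight :
  (G : Graph n m) (ℓ : SetFun n) → TwoIntersectingSupermodular ℓ →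
  (F : Subset m) → Sparse G ℓ F → {x y : Fin n} → x ≢ y →
  (VQ : Subset n) (EQ : Subset m) → IsSubgraphOf G VQ EQ F → Rigid G ℓ VQ EQ →
  x ∈ VQ → y ∈ VQ →
  (∀ (W : Subset n) (T : Subset m) → IsSubgraphOf G W T F → Rigid G ℓ W T →
     x ∈ W → y ∈ W → ∣ VQ ∣ ≤ ∣ W ∣) →
  ∀ {X} → Tight G ℓ F X → x ∈ X → y ∈ X → VQ ⊆ X
minimal-rigid⊆tight G ℓ sup F F-sparse x≢y VQ EQ Q⊆F Q-rigid x∈VQ y∈VQ minimal {X}
                    X-tight x∈X y∈X =
  ∣q∣≤∣p∩q∣⇒q⊆p X VQ (minimal W _ (induced-isSubgraphOf G F W)
                                   (tight⇒induced-rigid G ℓ F F-sparse W-tight) x∈W y∈W)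
  where
  W = X ∩ VQ
  x∈W = x∈p∩q⁺ (x∈X , x∈VQ)
  y∈W = x∈p∩q⁺ (y∈X , y∈VQ)
  W-tight : Tight G ℓ F W
  W-tight = tight-∩ G ℓ F F-sparse sup (x∈p∧y∈p∧x≢y⇒2≤∣p∣ W x∈W y∈W x≢y)
                    X-tight (rigid⇒tight G ℓ Q⊆F Q-rigid)

proposition2p2 : {n m : ℕ} (G : Graph n m) (ℓ : SetFun n) →
    ℓ ⊥ ≡ 0ℤ → TwoIntersectingSupermodular ℓ → WeaklySubadditive ℓ →
    (F : Subset m) → Sparse G ℓ F →
    (f : Fin m) → f ∉ F → (x y : Fin n) → ends G f ≡ (x , y) →
    (VQ : Subset n) (EQ : Subset m) →
    IsSubgraphOf G VQ EQ F → Rigid G ℓ VQ EQ → x ∈ VQ → y ∈ VQ →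
    (∀ (W : Subset n) (T : Subset m) → IsSubgraphOf G W T F → Rigid G ℓ W T →
       x ∈ W → y ∈ W → ∣ VQ ∣ ≤ ∣ W ∣) →
    (e : Fin m) → e ∈ EQ → Sparse G ℓ ((F ─ ⁅ e ⁆) ∪ ⁅ f ⁆)
proposition2p2 G ℓ _ sup _ F F-sparse f _ x y ends-f VQ EQ Q⊆F Q-rigid x∈VQ y∈VQ minimal
               e e∈EQ X
  with f ∈? inside G X | e ∈? inside G X
... | no f∉X | _ =
  ℤP.≤-trans (+≤+ (y∉q⇒∣[p-x]∪⁅y⁆∩q∣≤∣p∩q∣ F (inside G X) f∉X)) (F-sparse X)
... | yes _ | yes e∈X =
  ℤP.≤-trans (+≤+ (x∈p∩q⇒∣[p-x]∪⁅y⁆∩q∣≤∣p∩q∣ F (inside G X) (x∈p∩q⁺ (proj₁ Q⊆F e∈EQ , e∈X))))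
             (F-sparse X)
... | yes f∈X | no e∉X with bound ℓ X ℤP.≤? + eIn G F X
...   | no X-loose =
  ℤP.≤-trans (+≤+ (∣[p-x]∪⁅y⁆∩q∣≤1+∣p∩q∣ F (inside G X))) (ℤP.i<j⇒suc[i]≤j (ℤP.≰⇒> X-loose))
...   | yes X-tight = contradiction (i∈inside⁺ G X (VQ⊆X u∈VQ) (VQ⊆X v∈VQ)) e∉X
  where
  x≢y : x ≢ y
  x≢y x≡y = loopless G f (trans (cong proj₁ ends-f) (trans x≡y (sym (cong proj₂ ends-f))))
  u∈VQ = proj₁ (proj₂ Q⊆F e e∈EQ)
  v∈VQ = proj₂ (proj₂ Q⊆F e e∈EQ)
  x∈X = subst (_∈ X) (cong proj₁ ends-f) (proj₁ (i∈inside⁻ G X f∈X))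
  y∈X = subst (_∈ X) (cong proj₂ ends-f) (proj₂ (i∈inside⁻ G X f∈X))
  VQ⊆X : VQ ⊆ X
  VQ⊆X = minimal-rigid⊆tight G ℓ sup F F-sparse x≢y VQ EQ Q⊆F Q-rigid x∈VQ y∈VQ minimal
                             X-tight x∈X y∈X
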